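{- Let $n,l,k$ be positive integers. Then $n$ divides $P'(\underbrace{k,k,\ldots,k}_{ln+1})$.
   Context: $P'(s_1,\dots,s_r)$ is the number of anagrams without fixed letters of the word $1^{s_1}2^{s_2}\cdots r^{s_r}$, i.e. the number of words $a_{1,1}\ldots a_{1,s_1}\ldots a_{r,1}\ldots a_{r,s_r}$ that are rearrangements of $1^{s_1}\cdots r^{s_r}$ with $a_{i,j}\neq i$ for all $i,j$. -}

module Defs where

open import Data.Nat using (ℕ; zero; suc; _≟_)
open import Data.Fin using (Fin)
import Data.Fin as Fin
open import Data.List using (List; []; _∷_; length; filter; map; concatMap; replicate; allFin)
open import Data.Nat.ListAction using (sum)
open import Data.List.Relation.Binary.Pointwise using (Pointwise; decidable)
open import Data.List.Relation.Unary.All using (All)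
import Data.List.Relation.Unary.All as All
open import Data.Product using (_×_)
open import Relation.Nullary using (¬_; Dec)
open import Relation.Nullary.Decidable using (_×-dec_; ¬?)
open import Relation.Binary.PropositionalEquality using (_≡_)

-- The word 1^{s_1} 2^{s_2} ... r^{s_r}, letters are Fin r (letter i ↦ Fin index i-1).
baseWord : (r : ℕ) → (Fin r → ℕ) → List (Fin r)
baseWord r s = concatMap (λ i → replicate (s i) i) (allFin r)

words : (r N : ℕ) → List (List (Fin r))
words r zero    = [] ∷ []
words r (suc N) = concatMap (λ a → map (a ∷_) (words r N)) (allFin r)

occ : {r : ℕ} → Fin r → List (Fin r) → ℕ
occ a w = length (filter (Fin._≟ a) w)

IsAnagram : (r : ℕ) → (s : Fin r → ℕ) → List (Fin r) → Set
IsAnagram r s w = All (λ a → occ a w ≡ s a) (allFin r)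

NoFixedLetter : (r : ℕ) → (s : Fin r → ℕ) → List (Fin r) → Set
NoFixedLetter r s w = Pointwise (λ x y → ¬ x ≡ y) w (baseWord r s)

good? : (r : ℕ) → (s : Fin r → ℕ) → (w : List (Fin r)) →
        Dec (IsAnagram r s w × NoFixedLetter r s w)
good? r s w =
  All.all? (λ a → occ a w ≟ s a) (allFin r)
  ×-dec decidable (λ x y → ¬? (x Fin.≟ y)) w (baseWord r s)

P′ : (r : ℕ) → (Fin r → ℕ) → ℕ
P′ r s = length (filter (good? r s) (words r (sum (map s (allFin r)))))

module Submission where

-- Let r = m + 2 letters 0, …, m + 1 each occur k ≥ 1 times, with base word
-- 0^k 1^k 2^k … (m+1)^k, and call a word good if it is an anagram of the base
-- word with no fixed letter.  Splitting the good words by their first letter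
-- gives P′ = Σ_a c a, where c a counts good words starting with a.  No good word
-- starts with 0, so c 0 = 0.  The map F that moves the positions of the block
-- of 1s to the end and renames the letters by 0 ↦ 0, 1 ↦ m + 1, i + 1 ↦ i fixes
-- the base word; hence it preserves goodness, is injective, and sends words
-- starting with i + 1 to words starting with prev i + 1.  So the counts
-- c 1, …, c (m + 1) do not increase along a cycle and are all equal, giving
-- P′ = (m + 1) · c 1.  Taking m + 1 = l · n + 1 proves the corollary.

open import Defs
open import Data.Nat using (ℕ; zero; suc; _+_; _*_; _∸_; _⊓_; _≤_; _≥_; z≤n; s≤s)
open import Data.Nat.Properties using (+-comm; +-suc; ≤-refl; ≤-trans; ≤-antisym; *-comm; suc-injective)
open import Data.Nat.Divisibility using (_∣_; divides; ∣-trans; n∣m*n)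
open import Data.Nat.ListAction using (sum)
open import Data.Fin using (Fin; zero; suc; fromℕ; inject₁)
open import Data.Fin.Properties using (_≟_; inject₁-injective; fromℕ≢inject₁)
import Data.Fin.Properties as FinProperties
open import Data.Fin.Relation.Unary.Top using (view; ‵fromℕ; ‵inj₁)
open import Data.List using (List; []; _∷_; [_]; _++_; _∷ʳ_; length; filter; map; take; drop; replicate; concatMap; allFin; tabulate; cartesianProductWith)
open import Data.List.Properties using (∷-injectiveʳ; map-injective; length-map; map-++; map-tabulate; map-replicate; length-replicate; concatMap-++; ++-identityʳ; length-++; length-drop; length-take; take++drop≡id; filter-++; filter-accept; filter-reject; filter-none; ∷-injective)
open import Data.List.Relation.Binary.Pointwise using (Pointwise; []; _∷_)
import Data.List.Relation.Binary.Pointwise as Pointwise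
open import Data.List.Relation.Binary.Permutation.Propositional using (_↭_; ↭-trans; ↭-reflexive)
open import Data.List.Relation.Binary.Permutation.Propositional.Properties using (↭-length; filter-↭; ++-comm; ++⁺ˡ)
open import Data.List.Relation.Unary.All using ([])
import Data.List.Relation.Unary.All as All
open import Data.List.Relation.Unary.Any using (here; there)
open import Data.List.Relation.Unary.Unique.Propositional using (Unique; []; _∷_)
import Data.List.Relation.Unary.Unique.Propositional.Properties as Unique
open import Data.List.Membership.Propositional using (_∈_)
open import Data.List.Membership.Propositional.Properties using (∈-∃++; ∈-++⁻; ∈-++⁺ˡ; ∈-++⁺ʳ; ∈-map⁺; ∈-map⁻; ∈-allFin; ∈-filter⁺; ∈-filter⁻; ∈-cartesianProductWith⁺; ∈-cartesianProductWith⁻)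
open import Data.Product using (_×_; _,_; proj₁; proj₂; ∃)
open import Data.Sum using (inj₁; inj₂)
open import Data.Empty using (⊥-elim)
open import Function using (_∘_)
open import Level using (Level)
open import Relation.Binary.PropositionalEquality using (_≡_; _≢_; refl; sym; trans; cong; cong₂; subst; module ≡-Reasoning)
open import Relation.Nullary using (¬_; yes; no)
open import Relation.Unary using (Decidable)

private variable
  a ℓ : Level
  A B : Set a

take-++-length : (xs ys : List A) → take (length xs) (xs ++ ys) ≡ xs
take-++-length []       ys = refl
take-++-length (x ∷ xs) ys = cong (x ∷_) (take-++-length xs ys)

drop-++-length : (xs ys : List A) → drop (length xs) (xs ++ ys) ≡ ys
drop-++-length []       ys = refl
drop-++-length (x ∷ xs) ys = drop-++-length xs ys

++-injective : ∀ (xs xs′ ys ys′ : List A) → length xs ≡ length xs′ →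
               xs ++ ys ≡ xs′ ++ ys′ → xs ≡ xs′ × ys ≡ ys′
++-injective xs xs′ ys ys′ len eq =
  trans (sym (take-++-length xs ys)) (trans (cong₂ take len eq) (take-++-length xs′ ys′)) ,
  trans (sym (drop-++-length xs ys)) (trans (cong₂ drop len eq) (drop-++-length xs′ ys′))

module _ {R : A → B → Set ℓ} where

  pointwise-take : ∀ n {xs ys} → Pointwise R xs ys → Pointwise R (take n xs) (take n ys)
  pointwise-take zero    _        = []
  pointwise-take (suc n) []       = []
  pointwise-take (suc n) (r ∷ rs) = r ∷ pointwise-take n rs

  pointwise-drop : ∀ n {xs ys} → Pointwise R xs ys → Pointwise R (drop n xs) (drop n ys)
  pointwise-drop zero    rs       = rs
  pointwise-drop (suc n) []       = []
  pointwise-drop (suc n) (_ ∷ rs) = pointwise-drop n rs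

rotate : ℕ → List A → List A
rotate k v = drop k v ++ take k v

rotate-↭ : ∀ k (v : List A) → rotate k v ↭ v
rotate-↭ k v = ↭-trans (++-comm (drop k v) (take k v)) (↭-reflexive (take++drop≡id k v))

rotate-pointwise : ∀ {R : A → B → Set ℓ} k {xs ys} →
                   Pointwise R xs ys → Pointwise R (rotate k xs) (rotate k ys)
rotate-pointwise k rs = Pointwise.++⁺ (pointwise-drop k rs) (pointwise-take k rs)

rotate-injective : ∀ k (v v′ : List A) → length v ≡ length v′ → rotate k v ≡ rotate k v′ → v ≡ v′
rotate-injective k v v′ len eq = begin
  v                       ≡⟨ take++drop≡id k v ⟨
  take k v ++ drop k v    ≡⟨ cong₂ _++_ (proj₂ split) (proj₁ split) ⟩
  take k v′ ++ drop k v′  ≡⟨ take++drop≡id k v′ ⟩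
  v′                      ∎
  where
  open ≡-Reasoning
  split = ++-injective (drop k v) (drop k v′) (take k v) (take k v′)
            (trans (length-drop k v) (trans (cong (_∸ k) len) (sym (length-drop k v′)))) eq

rotate-block : (xs ys : List A) → rotate (length xs) (xs ++ ys) ≡ ys ++ xs
rotate-block xs ys = cong₂ _++_ (drop-++-length xs ys) (take-++-length xs ys)

shiftTail : ℕ → List A → List A
shiftTail k w = take k w ++ rotate k (drop k w)

shiftTail-↭ : ∀ k (w : List A) → shiftTail k w ↭ w
shiftTail-↭ k w = ↭-trans (++⁺ˡ (take k w) (rotate-↭ k (drop k w))) (↭-reflexive (take++drop≡id k w))

shiftTail-pointwise : ∀ {R : A → B → Set ℓ} k {xs ys} →
                      Pointwise R xs ys → Pointwise R (shiftTail k xs) (shiftTail k ys)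
shiftTail-pointwise k rs = Pointwise.++⁺ (pointwise-take k rs) (rotate-pointwise k (pointwise-drop k rs))

shiftTail-injective : ∀ k (w w′ : List A) → length w ≡ length w′ → shiftTail k w ≡ shiftTail k w′ → w ≡ w′
shiftTail-injective k w w′ len eq = begin
  w                       ≡⟨ take++drop≡id k w ⟨
  take k w ++ drop k w    ≡⟨ cong₂ _++_ (proj₁ split) tails ⟩
  take k w′ ++ drop k w′  ≡⟨ take++drop≡id k w′ ⟩
  w′                      ∎
  where
  open ≡-Reasoning
  split = ++-injective (take k w) (take k w′) _ _
            (trans (length-take k w) (trans (cong (k ⊓_) len) (sym (length-take k w′)))) eq
  tails = rotate-injective k (drop k w) (drop k w′)
            (trans (length-drop k w) (trans (cong (_∸ k) len) (sym (length-drop k w′)))) (proj₂ split)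

shiftTail-blocks : (xs ys zs : List A) → length ys ≡ length xs →
                   shiftTail (length xs) (xs ++ ys ++ zs) ≡ xs ++ zs ++ ys
shiftTail-blocks xs ys zs len = begin
  shiftTail (length xs) (xs ++ ys ++ zs)
    ≡⟨ cong₂ (λ u v → u ++ rotate (length xs) v) (take-++-length xs _) (drop-++-length xs _) ⟩
  xs ++ rotate (length xs) (ys ++ zs)
    ≡⟨ cong (λ n → xs ++ rotate n (ys ++ zs)) len ⟨
  xs ++ rotate (length ys) (ys ++ zs)
    ≡⟨ cong (xs ++_) (rotate-block ys zs) ⟩
  xs ++ zs ++ ys
    ∎
  where open ≡-Reasoning

∈-delete : ∀ {y z : A} ys₁ {ys₂} → y ∈ ys₁ ++ z ∷ ys₂ → y ≢ z → y ∈ ys₁ ++ ys₂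
∈-delete ys₁ y∈ y≢z with ∈-++⁻ ys₁ y∈
... | inj₁ p         = ∈-++⁺ˡ p
... | inj₂ (here e)  = ⊥-elim (y≢z e)
... | inj₂ (there p) = ∈-++⁺ʳ ys₁ p

length-insert : ∀ (ys₁ : List A) z ys₂ → length (ys₁ ++ z ∷ ys₂) ≡ suc (length (ys₁ ++ ys₂))
length-insert ys₁ z ys₂ = begin
  length (ys₁ ++ z ∷ ys₂)          ≡⟨ length-++ ys₁ ⟩
  length ys₁ + suc (length ys₂)    ≡⟨ +-suc (length ys₁) (length ys₂) ⟩
  suc (length ys₁ + length ys₂)    ≡⟨ cong suc (length-++ ys₁) ⟨
  suc (length (ys₁ ++ ys₂))        ∎
  where open ≡-Reasoning

length-≤-by-injection : ∀ {xs : List A} (ys : List B) (f : A → B) → Unique xs →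
                        (∀ {x} → x ∈ xs → f x ∈ ys) →
                        (∀ {x y} → x ∈ xs → y ∈ xs → f x ≡ f y → x ≡ y) →
                        length xs ≤ length ys
length-≤-by-injection {xs = []}     ys f _          _     _   = z≤n
length-≤-by-injection {xs = x ∷ xs} ys f (x∉ ∷ uniq) maps inj
  with ys₁ , ys₂ , refl ← ∈-∃++ (maps (here refl)) =
  subst (suc (length xs) ≤_) (sym (length-insert ys₁ (f x) ys₂)) (s≤s rest)
  where
  rest : length xs ≤ length (ys₁ ++ ys₂)
  rest = length-≤-by-injection (ys₁ ++ ys₂) f uniq
    (λ y∈ → ∈-delete ys₁ (maps (there y∈))
              (λ e → All.lookup x∉ y∈ (sym (inj (there y∈) (here refl) e))))
    (λ p q → inj (there p) (there q))

occ-↭ : ∀ {r} (a : Fin r) {v w} → v ↭ w → occ a v ≡ occ a w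
occ-↭ a p = ↭-length (filter-↭ (_≟ a) p)

occ-map : ∀ {r} (ρ : Fin r → Fin r) → (∀ {x y} → ρ x ≡ ρ y → x ≡ y) →
          ∀ a v → occ (ρ a) (map ρ v) ≡ occ a v
occ-map ρ inj a []      = refl
occ-map ρ inj a (x ∷ v) with x ≟ a
... | yes refl = trans (cong length (filter-accept (_≟ ρ a) {xs = map ρ v} refl))
                       (cong suc (occ-map ρ inj a v))
... | no x≢a   = trans (cong length (filter-reject (_≟ ρ a) {xs = map ρ v} (x≢a ∘ inj)))
                       (occ-map ρ inj a v)

words-suc : ∀ r N → words r (suc N) ≡ cartesianProductWith _∷_ (allFin r) (words r N)
words-suc r N = go (allFin r)
  where
  go : ∀ as → concatMap (λ a → map (a ∷_) (words r N)) as ≡ cartesianProductWith _∷_ as (words r N)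
  go []       = refl
  go (a ∷ as) = cong (map (a ∷_) (words r N) ++_) (go as)

∈-words⁺ : ∀ {r} N (w : List (Fin r)) → length w ≡ N → w ∈ words r N
∈-words⁺ zero    []      _   = here refl
∈-words⁺ {r} (suc N) (a ∷ w) len rewrite words-suc r N =
  ∈-cartesianProductWith⁺ _∷_ (∈-allFin a) (∈-words⁺ N w (suc-injective len))

∈-words⁻ : ∀ {r} N (w : List (Fin r)) → w ∈ words r N → length w ≡ N
∈-words⁻ zero    w (here refl) = refl
∈-words⁻ {r} (suc N) w w∈ rewrite words-suc r N
  with _ , t , _ , t∈ , refl ← ∈-cartesianProductWith⁻ _∷_ (allFin r) (words r N) w∈ =
  cong suc (∈-words⁻ N t t∈)

words-unique : ∀ r N → Unique (words r N)
words-unique r zero    = [] ∷ []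
words-unique r (suc N) rewrite words-suc r N =
  Unique.cartesianProductWith⁺ _∷_ ∷-injective (Unique.allFin⁺ r) (words-unique r N)

length-filter-concatMap : ∀ {p} {P : B → Set p} (P? : Decidable P) (f : A → List B) xs →
  length (filter P? (concatMap f xs)) ≡ sum (map (λ x → length (filter P? (f x))) xs)
length-filter-concatMap P? f []       = refl
length-filter-concatMap P? f (x ∷ xs) = begin
  length (filter P? (f x ++ concatMap f xs))
    ≡⟨ cong length (filter-++ P? (f x) (concatMap f xs)) ⟩
  length (filter P? (f x) ++ filter P? (concatMap f xs))
    ≡⟨ length-++ (filter P? (f x)) ⟩
  length (filter P? (f x)) + length (filter P? (concatMap f xs))
    ≡⟨ cong (length (filter P? (f x)) +_) (length-filter-concatMap P? f xs) ⟩
  length (filter P? (f x)) + sum (map (λ y → length (filter P? (f y))) xs)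
    ∎
  where open ≡-Reasoning

sum-tabulate-constant : ∀ {n} (f : Fin n → ℕ) v → (∀ i → f i ≡ v) → sum (tabulate f) ≡ n * v
sum-tabulate-constant {zero}  f v eq = refl
sum-tabulate-constant {suc n} f v eq = cong₂ _+_ (eq zero) (sum-tabulate-constant (f ∘ suc) v (eq ∘ suc))

prev : ∀ {n} → Fin (suc n) → Fin (suc n)
prev {n} zero = fromℕ n
prev (suc i)  = inject₁ i

prev-injective : ∀ {n} {i j : Fin (suc n)} → prev i ≡ prev j → i ≡ j
prev-injective {i = zero}  {zero}  _ = refl
prev-injective {i = zero}  {suc j} e = ⊥-elim (fromℕ≢inject₁ e)
prev-injective {i = suc i} {zero}  e = ⊥-elim (fromℕ≢inject₁ (sym e))
prev-injective {i = suc i} {suc j} e = cong suc (inject₁-injective e)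

prev-surjective : ∀ {n} (j : Fin (suc n)) → ∃ λ i → prev i ≡ j
prev-surjective j with view j
... | ‵fromℕ          = zero , refl
... | ‵inj₁ {i = i} _ = suc i , refl

below-first : ∀ {n} (f : Fin (suc n) → ℕ) → (∀ i → f (suc i) ≤ f (inject₁ i)) → ∀ j → f j ≤ f zero
below-first         f step zero    = ≤-refl
below-first {suc n} f step (suc j) = ≤-trans (below-first (f ∘ suc) (step ∘ suc) j) (step zero)

above-last : ∀ {n} (f : Fin (suc n) → ℕ) → (∀ i → f (suc i) ≤ f (inject₁ i)) → ∀ j → f (fromℕ n) ≤ f j
above-last {zero}  f step zero    = ≤-refl
above-last {suc n} f step zero    = ≤-trans (above-last (f ∘ suc) (step ∘ suc) zero) (step zero)
above-last {suc n} f step (suc j) = above-last (f ∘ suc) (step ∘ suc) j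

cyclic-≤⇒constant : ∀ {n} (f : Fin (suc n) → ℕ) → (∀ i → f i ≤ f (prev i)) → ∀ j → f j ≡ f zero
cyclic-≤⇒constant f step j =
  ≤-antisym (below-first f (step ∘ suc) j) (≤-trans (step zero) (above-last f (step ∘ suc) j))

relabel : ∀ {n} → Fin (suc (suc n)) → Fin (suc (suc n))
relabel zero    = zero
relabel (suc i) = suc (prev i)

relabel-injective : ∀ {n} {i j : Fin (suc (suc n))} → relabel i ≡ relabel j → i ≡ j
relabel-injective {i = zero}  {zero}  _ = refl
relabel-injective {i = suc i} {suc j} e = cong suc (prev-injective (FinProperties.suc-injective e))

relabel-surjective : ∀ {n} (j : Fin (suc (suc n))) → ∃ λ i → relabel i ≡ j
relabel-surjective zero    = zero , refl
relabel-surjective (suc j) with i , refl ← prev-surjective j = suc i , refl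

tabulate-snoc : ∀ n (f : Fin (suc n) → A) → tabulate f ≡ tabulate (f ∘ inject₁) ∷ʳ f (fromℕ n)
tabulate-snoc zero    f = refl
tabulate-snoc (suc n) f = cong (f zero ∷_) (tabulate-snoc n (f ∘ suc))

upper : ∀ n → List (Fin (suc (suc n)))
upper n = tabulate {n = n} (λ i → suc (suc i))

relabel-order : ∀ n → map relabel (zero ∷ (upper n ∷ʳ suc zero)) ≡ allFin (suc (suc n))
relabel-order n = cong (zero ∷_) (begin
  map relabel (upper n ∷ʳ suc zero)                   ≡⟨ map-++ relabel (upper n) _ ⟩
  map relabel (upper n) ∷ʳ suc (fromℕ n)              ≡⟨ cong (_∷ʳ suc (fromℕ n)) (map-tabulate _ relabel) ⟩
  tabulate (λ i → suc (inject₁ i)) ∷ʳ suc (fromℕ n)   ≡⟨ tabulate-snoc n suc ⟨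
  tabulate suc                                        ∎)
  where open ≡-Reasoning

map-blocks : ∀ (f : A → B) k xs → map f (concatMap (replicate k) xs) ≡ concatMap (replicate k) (map f xs)
map-blocks f k []       = refl
map-blocks f k (x ∷ xs) = trans (map-++ f (replicate k x) _) (cong₂ _++_ (map-replicate f k x) (map-blocks f k xs))

concatMap-snoc : ∀ (g : A → List B) xs x → concatMap g (xs ∷ʳ x) ≡ concatMap g xs ++ g x
concatMap-snoc g xs x = trans (concatMap-++ g xs [ x ]) (cong (concatMap g xs ++_) (++-identityʳ (g x)))

module ConstantMultiplicity (m k′ : ℕ) where

  r k : ℕ
  r = suc (suc m)
  k = suc k′

  s : Fin r → ℕ
  s _ = k

  base : List (Fin r)
  base = baseWord r s

  -- The map behind the whole argument: move the block of 1s in the base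
  -- word to the end, then rename 1 ↦ m + 1 and i + 1 ↦ i for i ≥ 1.
  F : List (Fin r) → List (Fin r)
  F w = map relabel (shiftTail k w)

  -- F fixes the base word: moving 1^k to the end gives 0^k 2^k … (m+1)^k 1^k,
  -- which relabels back to the base word.
  F-base : F base ≡ base
  F-base = begin
    map relabel (shiftTail k (block zero ++ block (suc zero) ++ rest))
      ≡⟨ cong (λ n → map relabel (shiftTail n (block zero ++ block (suc zero) ++ rest))) (length-replicate k) ⟨
    map relabel (shiftTail (length (block zero)) (block zero ++ block (suc zero) ++ rest))
      ≡⟨ cong (map relabel) (shiftTail-blocks (block zero) (block (suc zero)) rest
                              (trans (length-replicate k) (sym (length-replicate k)))) ⟩
    map relabel (block zero ++ rest ++ block (suc zero))
      ≡⟨ cong (λ u → map relabel (block zero ++ u)) (concatMap-snoc block (upper m) (suc zero)) ⟨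
    map relabel (concatMap block (zero ∷ (upper m ∷ʳ suc zero)))
      ≡⟨ map-blocks relabel k (zero ∷ (upper m ∷ʳ suc zero)) ⟩
    concatMap block (map relabel (zero ∷ (upper m ∷ʳ suc zero)))
      ≡⟨ cong (concatMap block) (relabel-order m) ⟩
    concatMap block (allFin r)
      ∎
    where
    open ≡-Reasoning
    block : Fin r → List (Fin r)
    block = replicate k
    rest : List (Fin r)
    rest = concatMap block (upper m)

  Good : List (Fin r) → Set
  Good w = IsAnagram r s w × NoFixedLetter r s w

  F-length : ∀ w → length (F w) ≡ length w
  F-length w = trans (length-map relabel (shiftTail k w)) (↭-length (shiftTail-↭ k w))

  F-injective : ∀ w w′ → length w ≡ length w′ → F w ≡ F w′ → w ≡ w′
  F-injective w w′ len eq = shiftTail-injective k w w′ len (map-injective relabel-injective eq)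

  -- F only permutes positions and renames letters bijectively, so every
  -- letter still occurs k times.
  F-anagram : ∀ {w} → IsAnagram r s w → IsAnagram r s (F w)
  F-anagram {w} counts = All.tabulate λ {a} _ → count a
    where
    count : ∀ a → occ a (F w) ≡ k
    count a with b , refl ← relabel-surjective a = begin
      occ (relabel b) (map relabel (shiftTail k w))  ≡⟨ occ-map relabel relabel-injective b (shiftTail k w) ⟩
      occ b (shiftTail k w)                          ≡⟨ occ-↭ b (shiftTail-↭ k w) ⟩
      occ b w                                        ≡⟨ All.lookup counts (∈-allFin b) ⟩
      k                                              ∎
      where open ≡-Reasoning

  -- F acts on the word and on the base word alike and fixes the latter, so
  -- position-wise disagreement with the base word is preserved.
  F-no-fixed-letter : ∀ {w} → NoFixedLetter r s w → NoFixedLetter r s (F w)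
  F-no-fixed-letter {w} differs = subst (Pointwise _≢_ (F w)) F-base
    (Pointwise.map⁺ relabel relabel
      (Pointwise.map (λ x≢y → x≢y ∘ relabel-injective) (shiftTail-pointwise k differs)))

  F-good : ∀ {w} → Good w → Good (F w)
  F-good {w} (anagram , differs) = F-anagram {w} anagram , F-no-fixed-letter {w} differs

  -- Good words have length k · r = N + 1; c a counts those with first letter a.
  N : ℕ
  N = k′ + sum (map s (tabulate suc))

  startingWith : Fin r → List (List (Fin r))
  startingWith a = filter (good? r s) (map (a ∷_) (words r N))

  c : Fin r → ℕ
  c a = length (startingWith a)

  P′-by-first-letter : P′ r s ≡ sum (map c (allFin r))
  P′-by-first-letter = length-filter-concatMap (good? r s) (λ a → map (a ∷_) (words r N)) (allFin r)

  ∈-startingWith⁻ : ∀ {a x} → x ∈ startingWith a → Good x × ∃ λ t → x ≡ a ∷ t × length t ≡ N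
  ∈-startingWith⁻ {a} x∈ with x∈words , good ← ∈-filter⁻ (good? r s) {xs = map (a ∷_) (words r N)} x∈
                         with t , t∈ , refl ← ∈-map⁻ (a ∷_) x∈words =
    good , t , refl , ∈-words⁻ N t t∈

  ∈-startingWith⁺ : ∀ {a t} → Good (a ∷ t) → length t ≡ N → a ∷ t ∈ startingWith a
  ∈-startingWith⁺ {a} {t} good len = ∈-filter⁺ (good? r s) (∈-map⁺ (a ∷_) (∈-words⁺ N t len)) good

  -- The base word starts with 0, so no good word does.
  c-zero : c zero ≡ 0
  c-zero = cong length (filter-none (good? r s) (All.tabulate bad))
    where
    bad : ∀ {x} → x ∈ map (zero ∷_) (words r N) → ¬ Good x
    bad x∈ good with _ , _ , refl ← ∈-map⁻ (zero ∷_) x∈ = Pointwise.head (proj₂ good) refl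

  -- F maps the good words starting with i + 1 injectively to good words
  -- starting with prev i + 1, since F (a ∷ t) starts with relabel a.
  c-step : ∀ i → c (suc i) ≤ c (suc (prev i))
  c-step i = length-≤-by-injection (startingWith (suc (prev i))) F
    (Unique.filter⁺ (good? r s) (Unique.map⁺ ∷-injectiveʳ (words-unique r N))) maps injective
    where
    maps : ∀ {x} → x ∈ startingWith (suc i) → F x ∈ startingWith (suc (prev i))
    maps x∈ with good , t , refl , len ← ∈-startingWith⁻ x∈ =
      ∈-startingWith⁺ (F-good good) (suc-injective (trans (F-length (suc i ∷ t)) (cong suc len)))

    injective : ∀ {x y} → x ∈ startingWith (suc i) → y ∈ startingWith (suc i) → F x ≡ F y → x ≡ y
    injective x∈ y∈ eq with _ , t , refl , len ← ∈-startingWith⁻ x∈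
                       with _ , t′ , refl , len′ ← ∈-startingWith⁻ y∈ =
      F-injective _ _ (cong suc (trans len (sym len′))) eq

  -- The counts c 1, …, c (m + 1) are equal, c 0 vanishes, hence P′ = (m + 1) · c 1.
  P′-divisible : suc m ∣ P′ r s
  P′-divisible = divides (c (suc zero)) (begin
    P′ r s                               ≡⟨ P′-by-first-letter ⟩
    c zero + sum (map c (tabulate suc))  ≡⟨ cong₂ _+_ c-zero (cong sum (map-tabulate suc c)) ⟩
    sum (tabulate (c ∘ suc))             ≡⟨ sum-tabulate-constant (c ∘ suc) _ (cyclic-≤⇒constant (c ∘ suc) c-step) ⟩
    suc m * c (suc zero)                 ≡⟨ *-comm (suc m) _ ⟩
    c (suc zero) * suc m                 ∎)
    where open ≡-Reasoning

P′-constant-divisible : ∀ m k → m ≥ 1 → k ≥ 1 → m ∣ P′ (m + 1) (λ (_ : Fin (m + 1)) → k)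
P′-constant-divisible (suc m′) (suc k′) _ _ =
  subst (λ r → suc m′ ∣ P′ (suc r) (λ (_ : Fin (suc r)) → suc k′)) (+-comm 1 m′)
        (ConstantMultiplicity.P′-divisible m′ k′)

corollary5p3 : (n l k : ℕ) → n ≥ 1 → l ≥ 1 → k ≥ 1 →
    n ∣ P′ (l * n + 1) (λ (_ : Fin (l * n + 1)) → k)
corollary5p3 (suc n′) (suc l′) k _ _ k≥1 =
  ∣-trans (n∣m*n (suc l′)) (P′-constant-divisible (suc l′ * suc n′) k (s≤s z≤n) k≥1)
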